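{- Every syntactic strengthening is a semantic strengthening: if $P,P'$ are syntactic protocols such that $P'_{ab}\rightarrow P_{ab}$ is valid for all agents $a\neq b$, then $P'(G)\subseteq P(G)$ for every initial gossip graph $G$.
   Context: Let $A$ be a finite set of agents. A gossip graph is $G=(A,N,S)$ with $N,S\subseteq A\times A$, $I\subseteq S\subseteq N$; $N_ab$: $a$ knows $b$'s number; $S_ab$: $a$ knows $b$'s secret; $G$ is initial if $S=I$. A call $ab$ is possible iff $N_ab$; executing it gives both $a$ and $b$ the union of their numbers and of their secrets. A gossip state is $(G,\sigma)$ with $G$ initial and $\sigma$ a sequence of calls each possible when made. Formulas of the gossip logic ($\top$, $N_ab$, $S_ab$, Boolean connectives, protocol-dependent knowledge $K_a^P$, program modalities $[\pi]$) are interpreted at gossip states; a formula is valid iff it is true at all gossip states. A syntactic protocol $P$ is given by protocol conditions $P_{ab}$ (formulas, $a\neq b$); $ab$ is $P$-permitted at $(G,\sigma)$ iff $G,\sigma\models N_ab\wedge P_{ab}$; the extension $P(G)$ is the set of call sequences built from $\epsilon$ by successively appending $P$-permitted calls. $P'$ is a syntactic strengthening of $P$ iff $P'_{ab}\rightarrow P_{ab}$ is valid for all $a\neq b$; $P'$ is a semantic strengthening of $P$ iff $P'(G)\subseteq P(G)$ for all initial $G$. -}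

module Defs where

open import Data.Nat using (ℕ)
open import Data.Fin using (Fin; _≟_)
open import Data.Bool using (Bool; true; false; if_then_else_; _∨_; T)
open import Data.Product using (Σ; _×_; _,_)
open import Data.Sum using (_⊎_)
open import Data.Unit using () renaming (⊤ to Unit)
open import Data.Empty using (⊥)
open import Relation.Nullary using (¬_)
open import Relation.Nullary.Decidable using (⌊_⌋)
open import Relation.Binary.PropositionalEquality using (_≡_; _≢_)
open import Relation.Binary.Construct.Closure.ReflexiveTransitive using (Star)

Agent : ℕ → Set
Agent n = Fin n

BRel : ℕ → Set
BRel n = Agent n → Agent n → Bool

record Graph (n : ℕ) : Set where
  constructor graph
  field
    N : BRel n
    S : BRel n
open Graph public

Id : ∀ {n} → BRel n
Id x y = ⌊ x ≟ y ⌋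

-- Initial gossip graph: S = I and I ⊆ N (hence I ⊆ S ⊆ N).
record InitialGraph (n : ℕ) : Set where
  constructor initial
  field
    Nᵢ    : BRel n
    Nrefl : ∀ a → Nᵢ a a ≡ true
open InitialGraph public

toGraph : ∀ {n} → InitialGraph n → Graph n
toGraph G = graph (Nᵢ G) Id

Call : ℕ → Set
Call n = Agent n × Agent n

infixl 5 _︔_
data Seq (n : ℕ) : Set where
  ε   : Seq n
  _︔_ : Seq n → Call n → Seq n

update : ∀ {n} → BRel n → Call n → BRel n
update R (a , b) x y =
  if ⌊ x ≟ a ⌋ ∨ ⌊ x ≟ b ⌋ then R a y ∨ R b y else R x y

callG : ∀ {n} → Graph n → Call n → Graph n
callG G ab = graph (update (N G) ab) (update (S G) ab)

_after_ : ∀ {n} → Graph n → Seq n → Graph n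
G after ε       = G
G after (σ ︔ c) = callG (G after σ) c

data Possible {n} (G : InitialGraph n) : Seq n → Set where
  ε   : Possible G ε
  snoc : ∀ {σ a b} → Possible G σ → a ≢ b →
         T (N (toGraph G after σ) a b) → Possible G (σ ︔ (a , b))

record GState (n : ℕ) : Set where
  constructor gstate
  field
    gr   : InitialGraph n
    seq  : Seq n
    poss : Possible gr seq
open GState public

cur : ∀ {n} → GState n → Graph n
cur s = toGraph (gr s) after seq s

SameRow : ∀ {n} → BRel n → BRel n → Agent n → Set
SameRow R R' a = ∀ y → R a y ≡ R' a y

SameInfo : ∀ {n} → Graph n → Graph n → Agent n → Set
SameInfo G H a = SameRow (N G) (N H) a × SameRow (S G) (S H) a

-- Epistemic (synchronous) indistinguishability for agent a.
Indist : ∀ {n} → Agent n → InitialGraph n → Seq n → InitialGraph n → Seq n → Set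
Indist a G ε H ε = SameInfo (toGraph G) (toGraph H) a
Indist a G ε H (τ ︔ _) = ⊥
Indist a G (σ ︔ _) H ε = ⊥
Indist a G (σ ︔ (b , c)) H (τ ︔ (d , e)) =
  Indist a G σ H τ ×
  ( (a ≢ b × a ≢ c × a ≢ d × a ≢ e)
  ⊎ ( (a ≡ b ⊎ a ≡ c) × b ≡ d × c ≡ e ×
      SameInfo (toGraph G after (σ ︔ (b , c))) (toGraph H after (τ ︔ (d , e))) a ) )

_~[_]_ : ∀ {n} → GState n → Agent n → GState n → Set
s ~[ a ] t = Indist a (gr s) (seq s) (gr t) (seq t)

-- Extension of a protocol whose conditions are interpreted by `sat`.
-- Ext sat G σ p : σ (with possibility witness p) is in P(G).
data Ext {n} (sat : Agent n → Agent n → GState n → Set) (G : InitialGraph n)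
         : (σ : Seq n) → Possible G σ → Set where
  ε    : Ext sat G ε ε
  snoc : ∀ {σ a b p} → Ext sat G σ p → (ne : a ≢ b)
         (q : T (N (toGraph G after σ) a b)) →
         sat a b (gstate G σ p) → Ext sat G (σ ︔ (a , b)) (snoc p ne q)

infixr 4 _⇒ᶠ_
data Form (n : ℕ) : Set
data Prog (n : ℕ) : Set

data Form n where
  ⊤ᶠ     : Form n
  Nᶠ Sᶠ  : Agent n → Agent n → Form n
  ¬ᶠ_    : Form n → Form n
  _∧ᶠ_ _∨ᶠ_ _⇒ᶠ_ : Form n → Form n → Form n
  Kᶠ     : Agent n → (Agent n → Agent n → Form n) → Form n → Form n
  [_]ᶠ_  : Prog n → Form n → Form n

data Prog n where
  ¿_    : Form n → Prog n
  callᵖ : Agent n → Agent n → Prog n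
  _⨾_   : Prog n → Prog n → Prog n
  _∪ᵖ_  : Prog n → Prog n → Prog n
  _⋆    : Prog n → Prog n

-- Syntactic protocol: conditions P_ab (only used for a ≢ b).
Protocol : ℕ → Set
Protocol n = Agent n → Agent n → Form n

extend : ∀ {n} (s : GState n) {a b : Agent n} → a ≢ b →
         T (N (cur s) a b) → GState n
extend (gstate G σ p) {a} {b} ne q = gstate G (σ ︔ (a , b)) (snoc p ne q)

_⊨_ : ∀ {n} → GState n → Form n → Set
⟦_⟧ : ∀ {n} → Prog n → GState n → GState n → Set

s ⊨ ⊤ᶠ = Unit
s ⊨ Nᶠ a b = T (N (cur s) a b)
s ⊨ Sᶠ a b = T (S (cur s) a b)
s ⊨ (¬ᶠ φ) = ¬ (s ⊨ φ)
s ⊨ (φ ∧ᶠ ψ) = (s ⊨ φ) × (s ⊨ ψ)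
s ⊨ (φ ∨ᶠ ψ) = (s ⊨ φ) ⊎ (s ⊨ ψ)
s ⊨ (φ ⇒ᶠ ψ) = (s ⊨ φ) → (s ⊨ ψ)
s ⊨ Kᶠ a P φ = ∀ (t : GState _) → s ~[ a ] t →
               Ext (λ c d u → u ⊨ P c d) (gr t) (seq t) (poss t) → t ⊨ φ
s ⊨ ([ π ]ᶠ φ) = ∀ t → ⟦ π ⟧ s t → t ⊨ φ

⟦ ¿ φ ⟧ s t = (s ≡ t) × (s ⊨ φ)
⟦ callᵖ a b ⟧ s t = Σ (a ≢ b) λ ne → Σ (T (N (cur s) a b)) λ q → t ≡ extend s ne q
⟦ π ⨾ ρ ⟧ s t = Σ (GState _) λ u → ⟦ π ⟧ s u × ⟦ ρ ⟧ u t
⟦ π ∪ᵖ ρ ⟧ s t = ⟦ π ⟧ s t ⊎ ⟦ ρ ⟧ s t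
⟦ π ⋆ ⟧ s t = Star ⟦ π ⟧ s t

Valid : ∀ {n} → Form n → Set
Valid φ = ∀ s → s ⊨ φ

_∈Ext_ : ∀ {n} → Seq n → Protocol n × InitialGraph n → Set
σ ∈Ext (P , G) = Σ (Possible G σ) (Ext (λ a b s → s ⊨ P a b) G σ)

SyntacticStrengthening : ∀ {n} → Protocol n → Protocol n → Set
SyntacticStrengthening P' P = ∀ a b → a ≢ b → Valid (P' a b ⇒ᶠ P a b)

SemanticStrengthening : ∀ {n} → Protocol n → Protocol n → Set
SemanticStrengthening {n} P' P =
  ∀ (G : InitialGraph n) (σ : Seq n) → σ ∈Ext (P' , G) → σ ∈Ext (P , G)

module Submission where

open import Data.Nat using (ℕ)
open import Data.Product using (_,_)
open import Relation.Binary.PropositionalEquality using (_≢_)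
open import Defs

Ext-mono : ∀ {n} {sat sat′ : Agent n → Agent n → GState n → Set} →
  (∀ a b → a ≢ b → ∀ s → sat a b s → sat′ a b s) →
  ∀ {G σ p} → Ext sat G σ p → Ext sat′ G σ p
Ext-mono sat⇒sat′ ε = ε
Ext-mono sat⇒sat′ (snoc {a = a} {b} e ne q s) =
  snoc (Ext-mono sat⇒sat′ e) ne q (sat⇒sat′ a b ne _ s)

proposition21 : ∀ (n : ℕ) (P P' : Protocol n) →
    SyntacticStrengthening P' P → SemanticStrengthening P' P
proposition21 n P P' P'⇒P G σ (p , e) = p , Ext-mono P'⇒P e
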